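{- Let $\mathbf{vtm}$ be the fixed point starting with $0$ of the morphism $f:0\mapsto012$, $1\mapsto02$, $2\mapsto1$. Then its additive complexity is the sequence $13^\omega$, i.e., $\rho^{\mathrm{add}}_{\mathbf{vtm}}(0)=1$ and $\rho^{\mathrm{add}}_{\mathbf{vtm}}(n)=3$ for all $n\ge1$.
   Context: Letters $0,1,2$ are regarded as integers. Words $u,v$ are additively equivalent if $|u|=|v|$ and $|u|_1+2|u|_2=|v|_1+2|v|_2$ ($|w|_a$ counts occurrences of $a$); $\rho^{\mathrm{add}}_{\mathbf{x}}(n)$ is the number of additive equivalence classes of length-$n$ factors of $\mathbf{x}$. -}

module Defs where

open import Data.Nat using (ℕ; zero; suc; _+_; _*_; _≤_)
open import Data.Fin using (Fin; toℕ)
open import Data.Fin.Patterns using (0F; 1F; 2F)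
open import Data.List using (List; []; _∷_; concatMap; length; map; applyUpTo)
open import Data.Nat.ListAction using (sum)
open import Data.List.Relation.Unary.Any using (Any)
open import Data.List.Relation.Unary.AllPairs using (AllPairs)
open import Relation.Nullary using (¬_)
open import Data.List.Relation.Unary.All using (All)
open import Data.Product using (Σ; ∃; _×_; _,_)
open import Relation.Binary.PropositionalEquality using (_≡_)

Letter : Set
Letter = Fin 3

Word∞ : Set
Word∞ = ℕ → Letter

f : Letter → List Letter
f 0F = 0F ∷ 1F ∷ 2F ∷ []
f 1F = 0F ∷ 2F ∷ []
f 2F = 1F ∷ []

fWord : List Letter → List Letter
fWord = concatMap f

fIter : ℕ → List Letter
fIter zero    = 0F ∷ []
fIter (suc k) = fWord (fIter k)

at : List Letter → ℕ → Letter
at []       _       = 0F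
at (a ∷ w)  zero    = a
at (a ∷ w)  (suc i) = at w i

-- The fixed point of f starting with 0: since f(0) = 0·u, each f^k(0) is a
-- prefix of f^(k+1)(0) and |f^k(0)| ≥ k+1, so the i-th letter of the fixed
-- point is the i-th letter of f^(i+1)(0).
vtm : Word∞
vtm i = at (fIter (suc i)) i

factor : Word∞ → ℕ → ℕ → List Letter
factor x i n = applyUpTo (λ j → x (i + j)) n

weight : List Letter → ℕ
weight w = sum (map toℕ w)

AddEquiv : List Letter → List Letter → Set
AddEquiv u v = (length u ≡ length v) × (weight u ≡ weight v)

-- ρ^add_x(n) = k : there are exactly k additive equivalence classes of
-- length-n factors of x.  Expressed via a list of k starting positions whose
-- factors are pairwise non-equivalent representatives, such that every
-- length-n factor is additively equivalent to one of the representatives.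
AddComplexity : Word∞ → ℕ → ℕ → Set
AddComplexity x n k =
  Σ (List ℕ) λ reps →
    (length reps ≡ k)
    × AllPairs (λ i j → ¬ AddEquiv (factor x i n) (factor x j n)) reps
    × (∀ i → Any (λ j → AddEquiv (factor x i n) (factor x j n)) reps)

-- With t the Thue–Morse sequence (t(2n) = t(n), t(2n+1) = 1 − t(n)), the word
-- vtm(i) = 1 + t(i) − t(i+1) is a fixed point of f: the image of the letter at j
-- is the block of this word starting at 2j + t(j).  Hence the weight of the
-- factor of length n at i telescopes to n + t(i) − t(i+n), one of n − 1, n, n + 1,
-- and additive classes are determined by it.  All three values occur because
-- every pair (t(i), t(i+d)) ∈ {0,1}² is realised for every d ≥ 1, by induction
-- on d through t(2j) = t(j) and t(2j+1) = 1 − t(j).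
module Submission where

open import Defs
open import Data.Fin using (toℕ)
open import Data.Fin.Patterns using (0F; 1F; 2F)
open import Data.List using ([]; _∷_; _++_; length; applyUpTo)
open import Data.List.Properties using (applyUpTo-∷ʳ; concatMap-++; ++-identityʳ; length-applyUpTo)
open import Data.List.Relation.Unary.Any using (Any; here; there)
open import Data.List.Relation.Unary.AllPairs using ([]; _∷_)
open import Data.List.Relation.Unary.All using ([]; _∷_)
open import Data.Nat using (ℕ; zero; suc; _+_; _≤_; _<_; _≥_; z≤n; s≤s; ⌊_/2⌋; parity)
open import Data.Nat.Induction using (<-rec)
open import Data.Nat.Properties
  using (+-suc; +-comm; +-identityʳ; suc-injective; ≤-refl; ≤-pred; ≤-trans; <-trans; n≤1+n; n<1+n;
         m≤n+m; +-mono-≤; <⇒≢; ⌊n/2⌋-mono; ⌊n/2⌋<n; ⌊n/2⌋≤n; n≡⌊n+n/2⌋; n≡⌈n+n/2⌉;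
         +-commutativeSemigroup)
open import Algebra.Properties.CommutativeSemigroup +-commutativeSemigroup using (x∙yz≈y∙xz; x∙yz≈yx∙z)
open import Data.Nat.Tactic.RingSolver using (solve-∀)
open import Data.Parity.Base as ℙ using (Parity; 0ℙ; 1ℙ; _⁻¹)
open import Data.Parity.Properties using (+-homo-+; p+p≡0ℙ; ⁻¹-selfInverse)
open import Data.Product using (∃; _×_; _,_)
open import Data.Sum using (_⊎_; inj₁; inj₂)
open import Function using (_∘_)
open import Relation.Nullary using (¬_)
open import Relation.Binary.PropositionalEquality
  using (_≡_; _≢_; refl; sym; trans; cong; cong₂; module ≡-Reasoning)

-- ⌊ n /2⌋ is not a structural subterm of n, hence the fuel k; every k ≥ n gives t(n).
thueMorse-within : ℕ → ℕ → Parity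
thueMorse-within zero    n = 0ℙ
thueMorse-within (suc k) n = parity n ℙ.+ thueMorse-within k ⌊ n /2⌋

thueMorse-within-stable : ∀ {k k′ n} → n ≤ k → n ≤ k′ → thueMorse-within k n ≡ thueMorse-within k′ n
thueMorse-within-stable {zero}  {zero}   _   _   = refl
thueMorse-within-stable {zero}  {suc k′} z≤n _   = thueMorse-within-stable {zero} {k′} z≤n z≤n
thueMorse-within-stable {suc k} {zero}   _   z≤n = thueMorse-within-stable {k} {zero} z≤n z≤n
thueMorse-within-stable {suc k} {suc k′} {n} n≤k n≤k′ =
  cong (parity n ℙ.+_) (thueMorse-within-stable (halve n≤k) (halve n≤k′))
  where
  halve : ∀ {m} → n ≤ suc m → ⌊ n /2⌋ ≤ m
  halve {m} n≤1+m = ≤-pred (≤-trans (s≤s (⌊n/2⌋-mono n≤1+m)) (⌊n/2⌋<n m))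

thueMorse : ℕ → Parity
thueMorse n = thueMorse-within n n

thueMorse-unfold : ∀ n → thueMorse n ≡ parity n ℙ.+ thueMorse ⌊ n /2⌋
thueMorse-unfold n = trans (thueMorse-within-stable ≤-refl (n≤1+n n))
  (cong (parity n ℙ.+_) (thueMorse-within-stable (⌊n/2⌋≤n n) ≤-refl))

parity-double : ∀ n → parity (n + n) ≡ 0ℙ
parity-double n = trans (+-homo-+ n n) (p+p≡0ℙ (parity n))

thueMorse-double : ∀ n → thueMorse (n + n) ≡ thueMorse n
thueMorse-double n = trans (thueMorse-unfold (n + n))
  (cong₂ ℙ._+_ (parity-double n) (cong thueMorse (sym (n≡⌊n+n/2⌋ n))))

thueMorse-suc-double : ∀ n → thueMorse (suc (n + n)) ≡ thueMorse n ⁻¹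
thueMorse-suc-double n = trans (thueMorse-unfold (suc (n + n)))
  (cong₂ ℙ._+_ (trans (+-homo-+ 1 (n + n)) (cong _⁻¹ (parity-double n)))
               (cong thueMorse (sym (n≡⌈n+n/2⌉ n))))

even-or-odd : ∀ n → ∃ λ m → n ≡ m + m ⊎ n ≡ suc (m + m)
even-or-odd zero          = 0 , inj₁ refl
even-or-odd (suc zero)    = 0 , inj₂ refl
even-or-odd (suc (suc n)) with even-or-odd n
... | m , inj₁ n≡2m   = suc m , inj₁ (cong suc (trans (cong suc n≡2m) (sym (+-suc m m))))
... | m , inj₂ n≡2m+1 = suc m , inj₂ (cong suc (cong suc (trans n≡2m+1 (sym (+-suc m m)))))

double-+ : ∀ j k → (j + j) + (k + k) ≡ (j + k) + (j + k)
double-+ = solve-∀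

suc-double-+ : ∀ j k → suc (j + j) + suc (k + k) ≡ (j + suc k) + (j + suc k)
suc-double-+ = solve-∀

PairsAtDistance : ℕ → Set
PairsAtDistance d = ∀ p q → ∃ λ i → thueMorse i ≡ p × thueMorse (i + d) ≡ q

thueMorse-pairsAtDistance : ∀ d → 0 < d → PairsAtDistance d
thueMorse-pairsAtDistance = <-rec (λ d → 0 < d → PairsAtDistance d) step
  where
  base : PairsAtDistance 1
  base 0ℙ 0ℙ = 5 , refl , refl
  base 0ℙ 1ℙ = 0 , refl , refl
  base 1ℙ 0ℙ = 2 , refl , refl
  base 1ℙ 1ℙ = 1 , refl , refl

  step : ∀ d → (∀ {e} → e < d → 0 < e → PairsAtDistance e) → 0 < d → PairsAtDistance d
  step d rec 0<d with even-or-odd d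
  ... | zero  , inj₁ refl with () ← 0<d
  ... | zero  , inj₂ refl = base
  ... | suc m , inj₁ refl = λ p q →
    let j , tj≡p , tj+k≡q = rec (s≤s (m≤n+m (suc m) m)) (s≤s z≤n) p q in
    j + j , trans (thueMorse-double j) tj≡p ,
    trans (cong thueMorse (double-+ j (suc m))) (trans (thueMorse-double (j + suc m)) tj+k≡q)
  ... | suc m , inj₂ refl = λ p q →
    let j , tj≡p⁻¹ , tj+k≡q = rec (s≤s (s≤s (m≤n+m (suc m) m))) (s≤s z≤n) (p ⁻¹) q in
    suc (j + j) , trans (thueMorse-suc-double j) (⁻¹-selfInverse (sym tj≡p⁻¹)) ,
    trans (cong thueMorse (suc-double-+ j (suc m))) (trans (thueMorse-double (j + suc (suc m))) tj+k≡q)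

applyUpTo-cong : ∀ {A : Set} {g h : ℕ → A} → (∀ i → g i ≡ h i) → ∀ n → applyUpTo g n ≡ applyUpTo h n
applyUpTo-cong g≗h zero    = refl
applyUpTo-cong g≗h (suc n) = cong₂ _∷_ (g≗h 0) (applyUpTo-cong (g≗h ∘ suc) n)

factor-suc : ∀ x i n → factor x i (suc n) ≡ x i ∷ factor x (suc i) n
factor-suc x i n = cong₂ _∷_ (cong x (+-identityʳ i)) (applyUpTo-cong (cong x ∘ +-suc i) n)

factor≡∷ : ∀ x {i n a w} → x i ≡ a → factor x (suc i) n ≡ w → factor x i (suc n) ≡ a ∷ w
factor≡∷ x {i} {n} xi≡a rest = trans (factor-suc x i n) (cong₂ _∷_ xi≡a rest)

prefix-++ : ∀ x m k → factor x 0 (m + k) ≡ factor x 0 m ++ factor x m k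
prefix-++ x zero    k = refl
prefix-++ x (suc m) k = cong (x 0 ∷_) (prefix-++ (x ∘ suc) m k)

prefix-suc : ∀ x n → factor x 0 (suc n) ≡ factor x 0 n ++ x n ∷ []
prefix-suc x n = sym (applyUpTo-∷ʳ x n)

at-prefix : ∀ x {i n} → i < n → at (factor x 0 n) i ≡ x i
at-prefix x {zero}  {suc n} _         = refl
at-prefix x {suc i} {suc n} (s≤s i<n) = at-prefix (x ∘ suc) i<n

bit : Parity → ℕ
bit 0ℙ = 0
bit 1ℙ = 1

-- Δletter p q is the letter 1 + p − q.
Δletter : Parity → Parity → Letter
Δletter 0ℙ 1ℙ = 0F
Δletter 0ℙ 0ℙ = 1F
Δletter 1ℙ 1ℙ = 1F
Δletter 1ℙ 0ℙ = 2F

bit+toℕ-Δletter : ∀ p q → bit q + toℕ (Δletter p q) ≡ suc (bit p)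
bit+toℕ-Δletter 0ℙ 1ℙ = refl
bit+toℕ-Δletter 0ℙ 0ℙ = refl
bit+toℕ-Δletter 1ℙ 1ℙ = refl
bit+toℕ-Δletter 1ℙ 0ℙ = refl

f-Δletter-window : ∀ (x : Word∞) s p q →
  x s ≡ Δletter p (p ⁻¹) → x (suc s) ≡ Δletter (p ⁻¹) q → x (suc (suc s)) ≡ Δletter q (q ⁻¹) →
  f (Δletter p q) ≡ factor x (bit p + s) (length (f (Δletter p q)))
f-Δletter-window x s 0ℙ 1ℙ e₀ e₁ e₂ = sym (factor≡∷ x e₀ (factor≡∷ x e₁ (factor≡∷ x e₂ refl)))
f-Δletter-window x s 0ℙ 0ℙ e₀ e₁ _  = sym (factor≡∷ x e₀ (factor≡∷ x e₁ refl))
f-Δletter-window x s 1ℙ 1ℙ _  e₁ e₂ = sym (factor≡∷ x e₁ (factor≡∷ x e₂ refl))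
f-Δletter-window x s 1ℙ 0ℙ _  e₁ _  = sym (factor≡∷ x e₁ refl)

length-f-Δletter : ∀ p q s → bit q + suc (suc s) ≡ length (f (Δletter p q)) + (bit p + s)
length-f-Δletter 0ℙ 1ℙ s = refl
length-f-Δletter 0ℙ 0ℙ s = refl
length-f-Δletter 1ℙ 1ℙ s = refl
length-f-Δletter 1ℙ 0ℙ s = refl

thueMorseΔ : Word∞
thueMorseΔ i = Δletter (thueMorse i) (thueMorse (suc i))

thueMorseΔ-double : ∀ n → thueMorseΔ (n + n) ≡ Δletter (thueMorse n) (thueMorse n ⁻¹)
thueMorseΔ-double n = cong₂ Δletter (thueMorse-double n) (thueMorse-suc-double n)

thueMorseΔ-suc-double : ∀ n → thueMorseΔ (suc (n + n)) ≡ Δletter (thueMorse n ⁻¹) (thueMorse (suc n))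
thueMorseΔ-suc-double n = cong₂ Δletter (thueMorse-suc-double n)
  (trans (cong (thueMorse ∘ suc) (sym (+-suc n n))) (thueMorse-double (suc n)))

imageStart : ℕ → ℕ
imageStart n = bit (thueMorse n) + (n + n)

imageStart-suc : ∀ n → imageStart (suc n) ≡ imageStart n + length (f (thueMorseΔ n))
imageStart-suc n = begin
  bit q + suc (n + suc n)                 ≡⟨ cong (λ k → bit q + suc k) (+-suc n n) ⟩
  bit q + suc (suc (n + n))               ≡⟨ length-f-Δletter p q (n + n) ⟩
  length (f (Δletter p q)) + imageStart n ≡⟨ +-comm _ (imageStart n) ⟩
  imageStart n + length (f (Δletter p q)) ∎
  where
  open ≡-Reasoning
  p = thueMorse n
  q = thueMorse (suc n)

f-thueMorseΔ : ∀ n → f (thueMorseΔ n) ≡ factor thueMorseΔ (imageStart n) (length (f (thueMorseΔ n)))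
f-thueMorseΔ n = f-Δletter-window thueMorseΔ (n + n) (thueMorse n) (thueMorse (suc n))
  (thueMorseΔ-double n) (thueMorseΔ-suc-double n)
  (trans (cong (thueMorseΔ ∘ suc) (sym (+-suc n n))) (thueMorseΔ-double (suc n)))

fWord-prefix-thueMorseΔ : ∀ n → fWord (factor thueMorseΔ 0 n) ≡ factor thueMorseΔ 0 (imageStart n)
fWord-prefix-thueMorseΔ zero    = refl
fWord-prefix-thueMorseΔ (suc n) = begin
  fWord (factor Δ 0 (suc n))
    ≡⟨ cong fWord (prefix-suc Δ n) ⟩
  fWord (factor Δ 0 n ++ Δ n ∷ [])
    ≡⟨ concatMap-++ f (factor Δ 0 n) _ ⟩
  fWord (factor Δ 0 n) ++ (f (Δ n) ++ [])
    ≡⟨ cong₂ _++_ (fWord-prefix-thueMorseΔ n) (++-identityʳ _) ⟩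
  factor Δ 0 (imageStart n) ++ f (Δ n)
    ≡⟨ cong (factor Δ 0 (imageStart n) ++_) (f-thueMorseΔ n) ⟩
  factor Δ 0 (imageStart n) ++ factor Δ (imageStart n) L
    ≡⟨ sym (prefix-++ Δ (imageStart n) L) ⟩
  factor Δ 0 (imageStart n + L)
    ≡⟨ cong (factor Δ 0) (sym (imageStart-suc n)) ⟩
  factor Δ 0 (imageStart (suc n)) ∎
  where
  open ≡-Reasoning
  Δ = thueMorseΔ
  L = length (f (Δ n))

<⇒suc<imageStart : ∀ {k n} → k < n → suc k < imageStart n
<⇒suc<imageStart {k} {n} k<n =
  ≤-trans (+-mono-≤ (≤-trans (s≤s z≤n) k<n) k<n) (m≤n+m (n + n) (bit (thueMorse n)))

fIter-prefix : ∀ k → ∃ λ n → k < n × fIter k ≡ factor thueMorseΔ 0 n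
fIter-prefix zero    = 1 , s≤s z≤n , refl
fIter-prefix (suc k) =
  let n , k<n , fIter≡prefix = fIter-prefix k in
  imageStart n , <⇒suc<imageStart k<n ,
  trans (cong fWord fIter≡prefix) (fWord-prefix-thueMorseΔ n)

vtm≡thueMorseΔ : ∀ i → vtm i ≡ thueMorseΔ i
vtm≡thueMorseΔ i =
  let n , 1+i<n , fIter≡prefix = fIter-prefix (suc i) in
  trans (cong (λ w → at w i) fIter≡prefix) (at-prefix thueMorseΔ (<-trans (n<1+n i) 1+i<n))

factorWeight : Word∞ → ℕ → ℕ → ℕ
factorWeight x n i = weight (factor x i n)

weight-telescopes : ∀ (x : Word∞) (φ : ℕ → ℕ) → (∀ k → φ (suc k) + toℕ (x k) ≡ suc (φ k)) →
  ∀ i n → φ (i + n) + weight (factor x i n) ≡ φ i + n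
weight-telescopes x φ jump i zero    = cong (λ k → φ k + 0) (+-identityʳ i)
weight-telescopes x φ jump i (suc n) = begin
  φ (i + suc n) + weight (factor x i (suc n))
    ≡⟨ cong₂ (λ k w → φ k + weight w) (+-suc i n) (factor-suc x i n) ⟩
  φ (suc i + n) + (toℕ (x i) + weight (factor x (suc i) n))
    ≡⟨ x∙yz≈y∙xz (φ (suc i + n)) (toℕ (x i)) _ ⟩
  toℕ (x i) + (φ (suc i + n) + weight (factor x (suc i) n))
    ≡⟨ cong (toℕ (x i) +_) (weight-telescopes x φ jump (suc i) n) ⟩
  toℕ (x i) + (φ (suc i) + n)
    ≡⟨ x∙yz≈yx∙z (toℕ (x i)) (φ (suc i)) n ⟩
  φ (suc i) + toℕ (x i) + n
    ≡⟨ cong (_+ n) (jump i) ⟩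
  suc (φ i) + n
    ≡⟨ sym (+-suc (φ i) n) ⟩
  φ i + suc n ∎
  where open ≡-Reasoning

-- endpointWeight m p q = (m + 1) + p − q.
endpointWeight : ℕ → Parity → Parity → ℕ
endpointWeight m 0ℙ 1ℙ = m
endpointWeight m 0ℙ 0ℙ = suc m
endpointWeight m 1ℙ 1ℙ = suc m
endpointWeight m 1ℙ 0ℙ = suc (suc m)

endpointWeight-unique : ∀ {w} m p q → bit q + w ≡ bit p + suc m → w ≡ endpointWeight m p q
endpointWeight-unique m 0ℙ 1ℙ = suc-injective
endpointWeight-unique m 0ℙ 0ℙ e = e
endpointWeight-unique m 1ℙ 1ℙ = suc-injective
endpointWeight-unique m 1ℙ 0ℙ e = e

vtm-factor-weight : ∀ m i → factorWeight vtm (suc m) i ≡ endpointWeight m (thueMorse i) (thueMorse (i + suc m))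
vtm-factor-weight m i = endpointWeight-unique m _ _ (weight-telescopes vtm (bit ∘ thueMorse) jump i (suc m))
  where
  jump : ∀ k → bit (thueMorse (suc k)) + toℕ (vtm k) ≡ suc (bit (thueMorse k))
  jump k = trans (cong (λ a → bit (thueMorse (suc k)) + toℕ a) (vtm≡thueMorseΔ k))
                 (bit+toℕ-Δletter (thueMorse k) (thueMorse (suc k)))

consecutiveWeights⇒AddComplexity-3 : ∀ (x : Word∞) n m →
  (∀ i → factorWeight x n i ≡ m ⊎ factorWeight x n i ≡ suc m ⊎ factorWeight x n i ≡ suc (suc m)) →
  (∃ λ i → factorWeight x n i ≡ m) → (∃ λ i → factorWeight x n i ≡ suc m) →
  (∃ λ i → factorWeight x n i ≡ suc (suc m)) →
  AddComplexity x n 3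
consecutiveWeights⇒AddComplexity-3 x n m classify (i₀ , w₀) (i₁ , w₁) (i₂ , w₂) =
  i₀ ∷ i₁ ∷ i₂ ∷ [] , refl ,
  (apart w₀ w₁ (<⇒≢ (n<1+n m)) ∷ apart w₀ w₂ (<⇒≢ (s≤s (n≤1+n m))) ∷ []) ∷
  (apart w₁ w₂ (<⇒≢ (n<1+n (suc m))) ∷ []) ∷ [] ∷ [] ,
  cover
  where
  sameWeight : ∀ {i j} → factorWeight x n i ≡ factorWeight x n j → AddEquiv (factor x i n) (factor x j n)
  sameWeight {i} {j} e = trans (length-applyUpTo _ n) (sym (length-applyUpTo _ n)) , e

  apart : ∀ {i j a b} → factorWeight x n i ≡ a → factorWeight x n j ≡ b → a ≢ b →
          ¬ AddEquiv (factor x i n) (factor x j n)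
  apart wi wj a≢b (_ , e) = a≢b (trans (sym wi) (trans e wj))

  cover : ∀ i → Any (λ j → AddEquiv (factor x i n) (factor x j n)) (i₀ ∷ i₁ ∷ i₂ ∷ [])
  cover i with classify i
  ... | inj₁ wi        = here (sameWeight (trans wi (sym w₀)))
  ... | inj₂ (inj₁ wi) = there (here (sameWeight (trans wi (sym w₁))))
  ... | inj₂ (inj₂ wi) = there (there (here (sameWeight (trans wi (sym w₂)))))

vtm-addComplexity-suc : ∀ m → AddComplexity vtm (suc m) 3
vtm-addComplexity-suc m =
  consecutiveWeights⇒AddComplexity-3 vtm (suc m) m
    (λ i → classify _ _ (vtm-factor-weight m i))
    (attain 0ℙ 1ℙ) (attain 0ℙ 0ℙ) (attain 1ℙ 0ℙ)
  where
  classify : ∀ {w} p q → w ≡ endpointWeight m p q → w ≡ m ⊎ w ≡ suc m ⊎ w ≡ suc (suc m)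
  classify 0ℙ 1ℙ e = inj₁ e
  classify 0ℙ 0ℙ e = inj₂ (inj₁ e)
  classify 1ℙ 1ℙ e = inj₂ (inj₁ e)
  classify 1ℙ 0ℙ e = inj₂ (inj₂ e)

  attain : ∀ p q → ∃ λ i → factorWeight vtm (suc m) i ≡ endpointWeight m p q
  attain p q =
    let i , ti≡p , ti+n≡q = thueMorse-pairsAtDistance (suc m) (s≤s z≤n) p q in
    i , trans (vtm-factor-weight m i) (cong₂ (endpointWeight m) ti≡p ti+n≡q)

theorem4p7 : AddComplexity vtm 0 1 × (∀ n → n ≥ 1 → AddComplexity vtm n 3)
theorem4p7 = (0 ∷ [] , refl , [] ∷ [] , λ _ → here (refl , refl)) ,
             λ { (suc m) _ → vtm-addComplexity-suc m }
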